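{- Let $\beta=\frac{1+\sqrt5}{2}$ and for each positive integer $n$ with Zeckendorf expansion $n=\sum_{j\ge0}\epsilon_jF_{j+2}$ let $\delta(n)=\frac1{\sqrt5}\sum_{j\ge0}\epsilon_j\beta^{j+2}$. Then $$\{\beta\delta(n):n\ge1\}\cup\{\beta\delta(n)+\tfrac1{\sqrt5}\beta^2:n\ge1\}=\{\delta(n):n\ge2\},$$ $$\{\beta\delta(n):n\ge1\}\cap\{\beta\delta(n)+\tfrac1{\sqrt5}\beta^2:n\ge1\}=\{\delta(n):n\ge1,\ d(n)=2\}.$$
   Context: Fibonacci numbers: $F_0=0,F_1=1,F_n=F_{n-1}+F_{n-2}$. Zeckendorf expansion: every positive integer $n$ is uniquely $n=\sum_{j\ge0}\epsilon_jF_{j+2}$ with $\epsilon_j\in\{0,1\}$, finitely many nonzero, $\epsilon_j\epsilon_{j+1}=0$. Let $k(n)=\min\{j:\epsilon_j=1\}$ and set $d(n)=0$ if $k(n)=0$, $d(n)=1$ if $k(n)$ is odd, $d(n)=2$ if $k(n)$ is even and $\ge2$. -}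

module Defs where

open import Data.Nat as ℕ using (ℕ; zero; suc)
open import Data.Integer using (+_)
open import Data.Rational as ℚ using (ℚ; 0ℚ; 1ℚ)
open import Data.Bool using (Bool; true; false; if_then_else_)
open import Data.List using (List; []; _∷_)
open import Data.Product using (_×_; ∃; _,_)
open import Data.Empty using (⊥)
open import Data.Unit using (⊤)
open import Relation.Binary.PropositionalEquality using (_≡_)

fib : ℕ → ℕ
fib zero = 0
fib (suc zero) = 1
fib (suc (suc n)) = fib (suc n) ℕ.+ fib n

-- The field ℚ(√5): a + b√5 represented as the pair (a , b).
-- Equality of such numbers (as reals) is equality of the pairs, since
-- √5 is irrational; ℚ is normalised so _≡_ is the right equality.

record Q5 : Set where
  constructor _+√5·_
  field
    re : ℚ
    ir : ℚ

infixl 6 _⊕_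
infixl 7 _⊗_

_⊕_ : Q5 → Q5 → Q5
(a +√5· b) ⊕ (c +√5· d) = (a ℚ.+ c) +√5· (b ℚ.+ d)

_⊗_ : Q5 → Q5 → Q5
(a +√5· b) ⊗ (c +√5· d) =
  ((a ℚ.* c) ℚ.+ ((+ 5 ℚ./ 1) ℚ.* (b ℚ.* d))) +√5· ((a ℚ.* d) ℚ.+ (b ℚ.* c))

𝟘 𝟙 : Q5
𝟘 = 0ℚ +√5· 0ℚ
𝟙 = 1ℚ +√5· 0ℚ

β : Q5
β = (+ 1 ℚ./ 2) +√5· (+ 1 ℚ./ 2)

-- 1/√5 = √5/5
inv√5 : Q5
inv√5 = 0ℚ +√5· (+ 1 ℚ./ 5)

_^_ : Q5 → ℕ → Q5
x ^ zero = 𝟙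
x ^ suc n = x ⊗ (x ^ n)

-- Digit strings ε = (ε_0, ε_1, …) as finite lists of bits (index j = position).

NoAdj : List Bool → Set
NoAdj [] = ⊤
NoAdj (true ∷ true ∷ _) = ⊥
NoAdj (_ ∷ bs) = NoAdj bs

valFrom : ℕ → List Bool → ℕ
valFrom j [] = 0
valFrom j (b ∷ bs) = (if b then fib (j ℕ.+ 2) else 0) ℕ.+ valFrom (suc j) bs

βsumFrom : ℕ → List Bool → Q5
βsumFrom j [] = 𝟘
βsumFrom j (b ∷ bs) = (if b then β ^ (j ℕ.+ 2) else 𝟘) ⊕ βsumFrom (suc j) bs

Zeck : List Bool → ℕ → Set
Zeck ε n = NoAdj ε × valFrom 0 ε ≡ n

δ : List Bool → Q5
δ ε = inv√5 ⊗ βsumFrom 0 ε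

-- k = min { j : ε_j = 1 } (value 0 when there is no 1; irrelevant for n ≥ 1)
kFrom : ℕ → List Bool → ℕ
kFrom j [] = 0
kFrom j (true ∷ bs) = j
kFrom j (false ∷ bs) = kFrom (suc j) bs

-- d as a function of k: 0 if k = 0, 1 if k odd, 2 if k even ≥ 2
dOfK : ℕ → ℕ
dOfK zero = 0
dOfK (suc zero) = 1
dOfK (suc (suc zero)) = 2
dOfK (suc (suc (suc k))) = dOfK (suc k)

dDigits : List Bool → ℕ
dDigits ε = dOfK (kFrom 0 ε)

InDelta : ℕ → Q5 → Set
InDelta m y = ∃ λ n → m ℕ.≤ n × ∃ λ ε → Zeck ε n × y ≡ δ ε

InA : Q5 → Set
InA y = ∃ λ n → 1 ℕ.≤ n × ∃ λ ε → Zeck ε n × y ≡ β ⊗ δ ε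

InB : Q5 → Set
InB y = ∃ λ n → 1 ℕ.≤ n × ∃ λ ε → Zeck ε n × y ≡ (β ⊗ δ ε) ⊕ (inv√5 ⊗ (β ^ 2))

InD : Q5 → Set
InD y = ∃ λ n → 1 ℕ.≤ n × ∃ λ ε → Zeck ε n × dDigits ε ≡ 2 × y ≡ δ ε

-- Reading a digit string from its lowest position, δ(0ε) = β δ(ε) and δ(1ε) = β δ(ε) + β²/√5,
-- so the two sets on the left consist of the values δ(0ε) and δ(1ε) for Zeckendorf strings ε ≠ 0.
-- 0ε is again a Zeckendorf string, and 1ε becomes one by repeated carrying 110 → 001, i.e.
-- β^(j+2) + β^(j+3) = β^(j+4), which moves the lowest one by an even distance; conversely every
-- expansion of an n ≥ 2 starts with 0 or with 10. The rational part of δ(ε) is n/2 (because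
-- β^m = (L_m + F_m √5)/2), so equal δ-values have equal n, and by uniqueness of the Zeckendorf
-- expansion a point of the intersection has its lowest one at an even position ≥ 2.  Conversely
-- borrowing 0^(2m+2)1 → 1(10)^(m+1) exhibits such a δ(n) as an element of the second set.
module Submission where

open import Defs
open import Data.Product using (_×_; _,_; ∃; ∃₂)
open import Data.Sum using (_⊎_; inj₁; inj₂)
open import Function.Bundles using (_⇔_; mk⇔)

open import Data.Bool using (Bool; true; false; if_then_else_)
open import Data.Empty using (⊥-elim)
import Data.Integer as ℤ
open import Data.List using (List; []; _∷_; _++_; _∷ʳ_; length; replicate)
open import Data.List.Properties using (length-++; length-replicate)
open import Data.List.Reverse using (Reverse; []; _∶_∶ʳ_; reverseView)
open import Data.Nat using (ℕ; zero; suc; _+_; _≤_; _<_; z≤n; s≤s; s≤s⁻¹)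
open import Data.Nat.Properties
  using (+-commutativeSemigroup; +-assoc; +-comm; +-suc; +-identityʳ; +-cancelʳ-≡; +-mono-≤; suc-injective;
         n<1+n; ≤-refl; ≤-trans; <⇒≱; m≤m+n; m≤n+m; n≤1+n; module ≤-Reasoning)
open import Algebra.Properties.CommutativeSemigroup +-commutativeSemigroup using (xy∙z≈y∙xz)
open import Data.Rational as ℚ using (ℚ; 0ℚ; 1ℚ)
import Data.Rational.Properties as ℚP
open import Data.Rational.Solver using (module +-*-Solver)
open import Data.Unit using (tt)
open import Relation.Binary.PropositionalEquality
  using (_≡_; _≢_; refl; sym; trans; cong; cong₂; subst; module ≡-Reasoning)

open +-*-Solver using (Polynomial; solve; _:+_; _:*_; _:=_; con)

-- Arithmetic in ℚ(√5)

⊕-identityˡ : ∀ x → 𝟘 ⊕ x ≡ x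
⊕-identityˡ (a +√5· b) = cong₂ _+√5·_ (ℚP.+-identityˡ a) (ℚP.+-identityˡ b)

⊕-comm : ∀ x y → x ⊕ y ≡ y ⊕ x
⊕-comm (a +√5· b) (c +√5· d) = cong₂ _+√5·_ (ℚP.+-comm a c) (ℚP.+-comm b d)

⊕-assoc : ∀ x y z → (x ⊕ y) ⊕ z ≡ x ⊕ (y ⊕ z)
⊕-assoc (a +√5· b) (c +√5· d) (e +√5· f) =
  cong₂ _+√5·_ (ℚP.+-assoc a c e) (ℚP.+-assoc b d f)

½ : ℚ
½ = ℤ.+ 1 ℚ./ 2

:0 :½ :5 : ∀ {n} → Polynomial n
:0 = con 0ℚ
:½ = con ½
:5 = con (ℤ.+ 5 ℚ./ 1)

⊗-zeroʳ : ∀ x → x ⊗ 𝟘 ≡ 𝟘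
⊗-zeroʳ (a +√5· b) = cong₂ _+√5·_
  (solve 2 (λ a b → a :* :0 :+ :5 :* (b :* :0) := :0) refl a b)
  (solve 2 (λ a b → a :* :0 :+ b :* :0 := :0) refl a b)

⊗-assoc : ∀ x y z → (x ⊗ y) ⊗ z ≡ x ⊗ (y ⊗ z)
⊗-assoc (a +√5· b) (c +√5· d) (e +√5· f) = cong₂ _+√5·_
  (solve 6 (λ a b c d e f →
       (a :* c :+ :5 :* (b :* d)) :* e :+ :5 :* ((a :* d :+ b :* c) :* f)
    := a :* (c :* e :+ :5 :* (d :* f)) :+ :5 :* (b :* (c :* f :+ d :* e))) refl a b c d e f)
  (solve 6 (λ a b c d e f →
       (a :* c :+ :5 :* (b :* d)) :* f :+ (a :* d :+ b :* c) :* e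
    := a :* (c :* f :+ d :* e) :+ b :* (c :* e :+ :5 :* (d :* f))) refl a b c d e f)

⊗-distribˡ-⊕ : ∀ x y z → x ⊗ (y ⊕ z) ≡ x ⊗ y ⊕ x ⊗ z
⊗-distribˡ-⊕ (a +√5· b) (c +√5· d) (e +√5· f) = cong₂ _+√5·_
  (solve 6 (λ a b c d e f →
       a :* (c :+ e) :+ :5 :* (b :* (d :+ f))
    := (a :* c :+ :5 :* (b :* d)) :+ (a :* e :+ :5 :* (b :* f))) refl a b c d e f)
  (solve 6 (λ a b c d e f →
       a :* (d :+ f) :+ b :* (c :+ e)
    := (a :* d :+ b :* c) :+ (a :* f :+ b :* e)) refl a b c d e f)

β²≡1+β : ∀ x → β ⊗ (β ⊗ x) ≡ x ⊕ β ⊗ x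
β²≡1+β (a +√5· b) = cong₂ _+√5·_
  (solve 2 (λ a b →
       :½ :* (:½ :* a :+ :5 :* (:½ :* b)) :+ :5 :* (:½ :* (:½ :* b :+ :½ :* a))
    := a :+ (:½ :* a :+ :5 :* (:½ :* b))) refl a b)
  (solve 2 (λ a b →
       :½ :* (:½ :* b :+ :½ :* a) :+ :½ :* (:½ :* a :+ :5 :* (:½ :* b))
    := b :+ (:½ :* b :+ :½ :* a)) refl a b)

re-inv√5⊗ : ∀ x → Q5.re (inv√5 ⊗ x) ≡ Q5.ir x
re-inv√5⊗ (a +√5· b) =
  solve 2 (λ a b → :0 :* a :+ :5 :* (con (ℤ.+ 1 ℚ./ 5) :* b) := b) refl a b

β^-carry : ∀ m → β ^ m ⊕ β ^ suc m ≡ β ^ suc (suc m)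
β^-carry m = sym (β²≡1+β (β ^ m))

βsumFrom-suc : ∀ j ε → βsumFrom (suc j) ε ≡ β ⊗ βsumFrom j ε
βsumFrom-suc j [] = sym (⊗-zeroʳ β)
βsumFrom-suc j (b ∷ ε) = begin
  term (suc j) b ⊕ βsumFrom (suc (suc j)) ε ≡⟨ cong₂ _⊕_ (shift b) (βsumFrom-suc (suc j) ε) ⟩
  β ⊗ term j b ⊕ β ⊗ βsumFrom (suc j) ε     ≡⟨ sym (⊗-distribˡ-⊕ β (term j b) _) ⟩
  β ⊗ (term j b ⊕ βsumFrom (suc j) ε)       ∎
  where
  open ≡-Reasoning
  term : ℕ → Bool → Q5
  term i b = if b then β ^ (i + 2) else 𝟘
  shift : ∀ b → term (suc j) b ≡ β ⊗ term j b
  shift true  = refl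
  shift false = sym (⊗-zeroʳ β)

-- The middle step holds by computation: inv√5 ⊗ β and β ⊗ inv√5 are the same constant.
inv√5⊗βsumFrom-1 : ∀ ε → inv√5 ⊗ βsumFrom 1 ε ≡ β ⊗ δ ε
inv√5⊗βsumFrom-1 ε = begin
  inv√5 ⊗ βsumFrom 1 ε          ≡⟨ cong (inv√5 ⊗_) (βsumFrom-suc 0 ε) ⟩
  inv√5 ⊗ (β ⊗ βsumFrom 0 ε)    ≡⟨ sym (⊗-assoc inv√5 β (βsumFrom 0 ε)) ⟩
  (inv√5 ⊗ β) ⊗ βsumFrom 0 ε    ≡⟨ ⊗-assoc β inv√5 (βsumFrom 0 ε) ⟩
  β ⊗ δ ε                        ∎
  where open ≡-Reasoning

δ-false∷ : ∀ ε → δ (false ∷ ε) ≡ β ⊗ δ ε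
δ-false∷ ε = trans (cong (inv√5 ⊗_) (⊕-identityˡ (βsumFrom 1 ε))) (inv√5⊗βsumFrom-1 ε)

δ-true∷ : ∀ ε → δ (true ∷ ε) ≡ β ⊗ δ ε ⊕ inv√5 ⊗ β ^ 2
δ-true∷ ε = begin
  inv√5 ⊗ (β ^ 2 ⊕ βsumFrom 1 ε)         ≡⟨ ⊗-distribˡ-⊕ inv√5 (β ^ 2) (βsumFrom 1 ε) ⟩
  inv√5 ⊗ β ^ 2 ⊕ inv√5 ⊗ βsumFrom 1 ε  ≡⟨ ⊕-comm (inv√5 ⊗ β ^ 2) (inv√5 ⊗ βsumFrom 1 ε) ⟩
  inv√5 ⊗ βsumFrom 1 ε ⊕ inv√5 ⊗ β ^ 2  ≡⟨ cong (_⊕ inv√5 ⊗ β ^ 2) (inv√5⊗βsumFrom-1 ε) ⟩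
  β ⊗ δ ε ⊕ inv√5 ⊗ β ^ 2                ∎
  where open ≡-Reasoning

βsumFrom-carry : ∀ j ε ζ → βsumFrom (2 + j) (true ∷ ε) ≡ βsumFrom (2 + j) ζ →
                 βsumFrom j (true ∷ true ∷ false ∷ ε) ≡ βsumFrom j (false ∷ false ∷ ζ)
βsumFrom-carry j ε ζ eq = begin
  β ^ (j + 2) ⊕ (β ^ suc (j + 2) ⊕ (𝟘 ⊕ S)) ≡⟨ cong (λ t → β ^ (j + 2) ⊕ (β ^ suc (j + 2) ⊕ t)) (⊕-identityˡ S) ⟩
  β ^ (j + 2) ⊕ (β ^ suc (j + 2) ⊕ S)       ≡⟨ sym (⊕-assoc (β ^ (j + 2)) _ S) ⟩
  (β ^ (j + 2) ⊕ β ^ suc (j + 2)) ⊕ S       ≡⟨ cong (_⊕ S) (β^-carry (j + 2)) ⟩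
  βsumFrom (2 + j) (true ∷ ε)               ≡⟨ eq ⟩
  βsumFrom (2 + j) ζ                        ≡⟨ sym (⊕-identityˡ (βsumFrom (2 + j) ζ)) ⟩
  𝟘 ⊕ βsumFrom (2 + j) ζ                    ≡⟨ sym (⊕-identityˡ (𝟘 ⊕ βsumFrom (2 + j) ζ)) ⟩
  𝟘 ⊕ (𝟘 ⊕ βsumFrom (2 + j) ζ)              ∎
  where
  open ≡-Reasoning
  S : Q5
  S = βsumFrom (3 + j) ε

-- The rational part of δ(ε) is half the integer encoded by ε

fromℕ : ℕ → ℚ
fromℕ zero    = 0ℚ
fromℕ (suc n) = 1ℚ ℚ.+ fromℕ n

fromℕ-homo-+ : ∀ m n → fromℕ (m + n) ≡ fromℕ m ℚ.+ fromℕ n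
fromℕ-homo-+ zero    n = sym (ℚP.+-identityˡ (fromℕ n))
fromℕ-homo-+ (suc m) n = trans (cong (1ℚ ℚ.+_) (fromℕ-homo-+ m n)) (sym (ℚP.+-assoc 1ℚ (fromℕ m) (fromℕ n)))

0≤fromℕ : ∀ n → 0ℚ ℚ.≤ fromℕ n
0≤fromℕ zero    = ℚP.≤-refl
0≤fromℕ (suc n) = ℚP.+-mono-≤ (ℚP.nonNegative⁻¹ 1ℚ) (0≤fromℕ n)

fromℕ-suc≢0 : ∀ n → fromℕ (suc n) ≢ 0ℚ
fromℕ-suc≢0 n eq = ℚP.<-irrefl refl (ℚP.<-≤-trans (ℚP.positive⁻¹ 1ℚ)
  (subst (1ℚ ℚ.≤_) eq (ℚP.+-mono-≤ (ℚP.≤-refl {1ℚ}) (0≤fromℕ n))))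

fromℕ-injective : ∀ {m n} → fromℕ m ≡ fromℕ n → m ≡ n
fromℕ-injective {zero}  {zero}  _  = refl
fromℕ-injective {zero}  {suc n} eq = ⊥-elim (fromℕ-suc≢0 n (sym eq))
fromℕ-injective {suc m} {zero}  eq = ⊥-elim (fromℕ-suc≢0 m eq)
fromℕ-injective {suc m} {suc n} eq = cong suc (fromℕ-injective (+-cancelˡ 1ℚ (fromℕ m) (fromℕ n) eq))
  where open import Algebra.Properties.Group ℚP.+-0-group using () renaming (∙-cancelˡ to +-cancelˡ)

½-injective : ∀ {p q} → ½ ℚ.* p ≡ ½ ℚ.* q → p ≡ q
½-injective {p} {q} eq = trans (sym (twice-½ p)) (trans (cong ((ℤ.+ 2 ℚ./ 1) ℚ.*_) eq) (twice-½ q))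
  where
  twice-½ : ∀ r → (ℤ.+ 2 ℚ./ 1) ℚ.* (½ ℚ.* r) ≡ r
  twice-½ r = trans (sym (ℚP.*-assoc (ℤ.+ 2 ℚ./ 1) ½ r)) (ℚP.*-identityˡ r)

½fromℕ-homo-+ : ∀ m n → ½ ℚ.* fromℕ m ℚ.+ ½ ℚ.* fromℕ n ≡ ½ ℚ.* fromℕ (m + n)
½fromℕ-homo-+ m n = trans (sym (ℚP.*-distribˡ-+ ½ (fromℕ m) (fromℕ n))) (cong (½ ℚ.*_) (sym (fromℕ-homo-+ m n)))

ir-β^ : ∀ m → Q5.ir (β ^ m) ≡ ½ ℚ.* fromℕ (fib m)
ir-β^ zero          = refl
ir-β^ (suc zero)    = refl
ir-β^ (suc (suc m)) = begin
  Q5.ir (β ^ suc (suc m))                         ≡⟨ cong Q5.ir (sym (β^-carry m)) ⟩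
  Q5.ir (β ^ m) ℚ.+ Q5.ir (β ^ suc m)             ≡⟨ cong₂ ℚ._+_ (ir-β^ m) (ir-β^ (suc m)) ⟩
  ½ ℚ.* fromℕ (fib m) ℚ.+ ½ ℚ.* fromℕ (fib (suc m)) ≡⟨ ½fromℕ-homo-+ (fib m) (fib (suc m)) ⟩
  ½ ℚ.* fromℕ (fib m + fib (suc m))               ≡⟨ cong (λ n → ½ ℚ.* fromℕ n) (+-comm (fib m) (fib (suc m))) ⟩
  ½ ℚ.* fromℕ (fib (suc (suc m)))                 ∎
  where open ≡-Reasoning

ir-βsumFrom : ∀ j ε → Q5.ir (βsumFrom j ε) ≡ ½ ℚ.* fromℕ (valFrom j ε)
ir-βsumFrom j []          = refl
ir-βsumFrom j (true ∷ ε)  = trans (cong₂ ℚ._+_ (ir-β^ (j + 2)) (ir-βsumFrom (suc j) ε))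
                                  (½fromℕ-homo-+ (fib (j + 2)) (valFrom (suc j) ε))
ir-βsumFrom j (false ∷ ε) = trans (ℚP.+-identityˡ _) (ir-βsumFrom (suc j) ε)

ir-βsumFrom≡⇒valFrom≡ : ∀ j a b → Q5.ir (βsumFrom j a) ≡ Q5.ir (βsumFrom j b) → valFrom j a ≡ valFrom j b
ir-βsumFrom≡⇒valFrom≡ j a b eq =
  fromℕ-injective (½-injective (trans (sym (ir-βsumFrom j a)) (trans eq (ir-βsumFrom j b))))

βsumFrom≡⇒valFrom≡ : ∀ j a b → βsumFrom j a ≡ βsumFrom j b → valFrom j a ≡ valFrom j b
βsumFrom≡⇒valFrom≡ j a b eq = ir-βsumFrom≡⇒valFrom≡ j a b (cong Q5.ir eq)

δ≡⇒valFrom≡ : ∀ a b → δ a ≡ δ b → valFrom 0 a ≡ valFrom 0 b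
δ≡⇒valFrom≡ a b eq = ir-βsumFrom≡⇒valFrom≡ 0 a b
  (trans (sym (re-inv√5⊗ (βsumFrom 0 a))) (trans (cong Q5.re eq) (re-inv√5⊗ (βsumFrom 0 b))))

-- Uniqueness of Zeckendorf expansions

fib-+2 : ∀ j → fib (j + 2) ≡ fib (suc (suc j))
fib-+2 j = cong fib (+-comm j 2)

1≤fib-suc : ∀ j → 1 ≤ fib (suc j)
1≤fib-suc zero    = s≤s z≤n
1≤fib-suc (suc j) = ≤-trans (1≤fib-suc j) (m≤m+n (fib (suc j)) (fib j))

digit : ℕ → Bool → ℕ
digit j b = if b then fib (j + 2) else 0

length-∷ʳ : ∀ (xs : List Bool) x → length (xs ∷ʳ x) ≡ suc (length xs)
length-∷ʳ xs x = trans (length-++ xs) (+-comm (length xs) 1)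

valFrom-∷ʳ : ∀ j xs x → valFrom j (xs ∷ʳ x) ≡ valFrom j xs + digit (j + length xs) x
valFrom-∷ʳ j []       x = trans (+-identityʳ (digit j x)) (cong (λ i → digit i x) (sym (+-identityʳ j)))
valFrom-∷ʳ j (y ∷ xs) x = begin
  digit j y + valFrom (suc j) (xs ∷ʳ x)                          ≡⟨ cong (digit j y +_) (valFrom-∷ʳ (suc j) xs x) ⟩
  digit j y + (valFrom (suc j) xs + digit (suc j + length xs) x) ≡⟨ sym (+-assoc (digit j y) _ _) ⟩
  valFrom j (y ∷ xs) + digit (suc j + length xs) x               ≡⟨ cong (λ i → valFrom j (y ∷ xs) + digit i x) (sym (+-suc j (length xs))) ⟩
  valFrom j (y ∷ xs) + digit (j + suc (length xs)) x             ∎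
  where open ≡-Reasoning

NoAdj-∷ʳ⁻ : ∀ xs x → NoAdj (xs ∷ʳ x) → NoAdj xs
NoAdj-∷ʳ⁻ []                 x _  = tt
NoAdj-∷ʳ⁻ (false ∷ xs)       x na = NoAdj-∷ʳ⁻ xs x na
NoAdj-∷ʳ⁻ (true ∷ [])        x _  = tt
NoAdj-∷ʳ⁻ (true ∷ true ∷ xs) x ()
NoAdj-∷ʳ⁻ (true ∷ false ∷ xs) x na = NoAdj-∷ʳ⁻ (false ∷ xs) x na

valFrom+fib≤fib : ∀ j ε → NoAdj ε → valFrom j ε + fib (suc j) ≤ fib (suc (suc (j + length ε)))
valFrom+fib≤fib j [] _ rewrite +-identityʳ j = m≤m+n (fib (suc j)) (fib j)
valFrom+fib≤fib j (false ∷ ε) na = begin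
  valFrom (suc j) ε + fib (suc j)       ≤⟨ +-mono-≤ (≤-refl {valFrom (suc j) ε}) (m≤m+n (fib (suc j)) (fib j)) ⟩
  valFrom (suc j) ε + fib (suc (suc j)) ≤⟨ valFrom+fib≤fib (suc j) ε na ⟩
  fib (suc (suc (suc j + length ε)))    ≡⟨ cong (λ i → fib (suc (suc i))) (sym (+-suc j (length ε))) ⟩
  fib (suc (suc (j + length (false ∷ ε)))) ∎
  where open ≤-Reasoning
valFrom+fib≤fib j (true ∷ []) _ rewrite fib-+2 j | +-identityʳ (fib (suc (suc j))) | +-comm j 1 = ≤-refl
valFrom+fib≤fib j (true ∷ true ∷ ε) ()
valFrom+fib≤fib j (true ∷ false ∷ ε) na = begin
  fib (j + 2) + valFrom (2 + j) ε + fib (suc j) ≡⟨ cong (λ t → t + valFrom (2 + j) ε + fib (suc j)) (fib-+2 j) ⟩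
  fib (2 + j) + valFrom (2 + j) ε + fib (suc j) ≡⟨ xy∙z≈y∙xz (fib (2 + j)) (valFrom (2 + j) ε) (fib (suc j)) ⟩
  valFrom (2 + j) ε + fib (3 + j)               ≤⟨ valFrom+fib≤fib (2 + j) ε na ⟩
  fib (2 + (2 + j + length ε))                  ≡⟨ cong (λ i → fib (2 + i)) (sym (trans (+-suc j (suc (length ε))) (cong suc (+-suc j (length ε))))) ⟩
  fib (2 + (j + length (true ∷ false ∷ ε)))     ∎
  where open ≤-Reasoning

valFrom<fib : ∀ j ε → NoAdj ε → valFrom j ε < fib (j + length ε + 2)
valFrom<fib j ε na = begin-strict
  valFrom j ε                    <⟨ n<1+n (valFrom j ε) ⟩
  suc (valFrom j ε)              ≡⟨ +-comm 1 (valFrom j ε) ⟩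
  valFrom j ε + 1                ≤⟨ +-mono-≤ (≤-refl {valFrom j ε}) (1≤fib-suc j) ⟩
  valFrom j ε + fib (suc j)      ≤⟨ valFrom+fib≤fib j ε na ⟩
  fib (suc (suc (j + length ε))) ≡⟨ sym (fib-+2 (j + length ε)) ⟩
  fib (j + length ε + 2)         ∎
  where open ≤-Reasoning

zeckendorf-unique-≡length : ∀ j {a b} → Reverse a → Reverse b → length a ≡ length b →
                            NoAdj a → NoAdj b → valFrom j a ≡ valFrom j b → a ≡ b
zeckendorf-unique-≡length j [] [] _ _ _ _ = refl
zeckendorf-unique-≡length j [] (ys ∶ _ ∶ʳ y) len _ _ _ with () ← trans len (length-∷ʳ ys y)
zeckendorf-unique-≡length j (xs ∶ _ ∶ʳ x) [] len _ _ _ with () ← trans (sym len) (length-∷ʳ xs x)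
zeckendorf-unique-≡length j (xs ∶ rxs ∶ʳ x) (ys ∶ rys ∶ʳ y) len na nb eq =
  same-top x y (trans (sym (valFrom-∷ʳ j xs x)) (trans eq (valFrom-∷ʳ j ys y)))
  where
  len′ : length xs ≡ length ys
  len′ = suc-injective (trans (sym (length-∷ʳ xs x)) (trans len (length-∷ʳ ys y)))

  same-init : valFrom j xs ≡ valFrom j ys → xs ≡ ys
  same-init = zeckendorf-unique-≡length j rxs rys len′ (NoAdj-∷ʳ⁻ xs x na) (NoAdj-∷ʳ⁻ ys y nb)

  top-dominates : ∀ us vs → length us ≡ length vs → NoAdj vs →
                  valFrom j us + digit (j + length us) true ≢ valFrom j vs + 0
  top-dominates us vs l nvs e = <⇒≱ (valFrom<fib j vs nvs) (begin
    fib (j + length vs + 2)                   ≡⟨ cong (λ i → fib (j + i + 2)) (sym l) ⟩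
    fib (j + length us + 2)                   ≤⟨ m≤n+m _ (valFrom j us) ⟩
    valFrom j us + digit (j + length us) true ≡⟨ trans e (+-identityʳ (valFrom j vs)) ⟩
    valFrom j vs                              ∎)
    where open ≤-Reasoning

  same-top : ∀ x y → valFrom j xs + digit (j + length xs) x ≡ valFrom j ys + digit (j + length ys) y →
             xs ∷ʳ x ≡ ys ∷ʳ y
  same-top true  true  e = cong (_∷ʳ true) (same-init (+-cancelʳ-≡ _ _ _
    (trans e (cong (λ i → valFrom j ys + digit (j + i) true) (sym len′)))))
  same-top false false e = cong (_∷ʳ false) (same-init (+-cancelʳ-≡ _ _ _ e))
  same-top true  false e = ⊥-elim (top-dominates xs ys len′ (NoAdj-∷ʳ⁻ ys y nb) e)
  same-top false true  e = ⊥-elim (top-dominates ys xs (sym len′) (NoAdj-∷ʳ⁻ xs x na) (sym e))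

zeros : ℕ → List Bool
zeros p = replicate p false

valFrom-++-zeros : ∀ j ε p → valFrom j (ε ++ zeros p) ≡ valFrom j ε
valFrom-++-zeros j []      zero    = refl
valFrom-++-zeros j []      (suc p) = valFrom-++-zeros (suc j) [] p
valFrom-++-zeros j (b ∷ ε) p       = cong (digit j b +_) (valFrom-++-zeros (suc j) ε p)

kFrom-++-zeros : ∀ j ε p → kFrom j (ε ++ zeros p) ≡ kFrom j ε
kFrom-++-zeros j []          zero    = refl
kFrom-++-zeros j []          (suc p) = kFrom-++-zeros (suc j) [] p
kFrom-++-zeros j (true ∷ ε)  p       = refl
kFrom-++-zeros j (false ∷ ε) p       = kFrom-++-zeros (suc j) ε p

NoAdj-++-zeros : ∀ ε p → NoAdj ε → NoAdj (ε ++ zeros p)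
NoAdj-++-zeros []                  zero    _  = tt
NoAdj-++-zeros []                  (suc p) _  = NoAdj-++-zeros [] p tt
NoAdj-++-zeros (false ∷ ε)         p       na = NoAdj-++-zeros ε p na
NoAdj-++-zeros (true ∷ [])         zero    _  = tt
NoAdj-++-zeros (true ∷ [])         (suc p) _  = NoAdj-++-zeros [] p tt
NoAdj-++-zeros (true ∷ true ∷ ε)   p       ()
NoAdj-++-zeros (true ∷ false ∷ ε)  p       na = NoAdj-++-zeros (false ∷ ε) p na

length-++-zeros : ∀ ε p → length (ε ++ zeros p) ≡ length ε + p
length-++-zeros ε p = trans (length-++ ε) (cong (length ε +_) (length-replicate p))

zeckendorf-unique : ∀ j a b → NoAdj a → NoAdj b → valFrom j a ≡ valFrom j b →
                    a ++ zeros (length b) ≡ b ++ zeros (length a)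
zeckendorf-unique j a b na nb eq = zeckendorf-unique-≡length j (reverseView _) (reverseView _)
  (trans (length-++-zeros a (length b)) (trans (+-comm (length a) (length b)) (sym (length-++-zeros b (length a)))))
  (NoAdj-++-zeros a _ na) (NoAdj-++-zeros b _ nb)
  (trans (valFrom-++-zeros j a _) (trans eq (sym (valFrom-++-zeros j b _))))

kFrom-unique : ∀ j a b → NoAdj a → NoAdj b → valFrom j a ≡ valFrom j b → kFrom j a ≡ kFrom j b
kFrom-unique j a b na nb eq = begin
  kFrom j a                      ≡⟨ sym (kFrom-++-zeros j a (length b)) ⟩
  kFrom j (a ++ zeros (length b)) ≡⟨ cong (kFrom j) (zeckendorf-unique j a b na nb eq) ⟩
  kFrom j (b ++ zeros (length a)) ≡⟨ kFrom-++-zeros j b (length a) ⟩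
  kFrom j b                      ∎
  where open ≡-Reasoning

NoAdj-∷⁻ : ∀ b ε → NoAdj (b ∷ ε) → NoAdj ε
NoAdj-∷⁻ false ε            na = na
NoAdj-∷⁻ true  []           _  = tt
NoAdj-∷⁻ true  (true ∷ ε)   ()
NoAdj-∷⁻ true  (false ∷ ε)  na = na

2≤fib-+3 : ∀ j → 2 ≤ fib (suc j + 2)
2≤fib-+3 j = subst (2 ≤_) (sym (fib-+2 (suc j))) (+-mono-≤ (1≤fib-suc (suc j)) (1≤fib-suc j))

1≤valFrom⇒2≤valFrom-suc : ∀ j ε → 1 ≤ valFrom j ε → 2 ≤ valFrom (suc j) ε
1≤valFrom⇒2≤valFrom-suc j (true ∷ ε)  _ = ≤-trans (2≤fib-+3 j) (m≤m+n _ _)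
1≤valFrom⇒2≤valFrom-suc j (false ∷ ε) p = 1≤valFrom⇒2≤valFrom-suc (suc j) ε p

1≤valFrom-suc⇒1≤valFrom : ∀ j ε → 1 ≤ valFrom (suc j) ε → 1 ≤ valFrom j ε
1≤valFrom-suc⇒1≤valFrom j (true ∷ ε)  _ = ≤-trans (subst (1 ≤_) (sym (fib-+2 j)) (1≤fib-suc (suc j))) (m≤m+n _ _)
1≤valFrom-suc⇒1≤valFrom j (false ∷ ε) p = 1≤valFrom-suc⇒1≤valFrom (suc j) ε p

1≤valFrom⇒≤kFrom : ∀ j ε → 1 ≤ valFrom j ε → j ≤ kFrom j ε
1≤valFrom⇒≤kFrom j (true ∷ ε)  _ = ≤-refl
1≤valFrom⇒≤kFrom j (false ∷ ε) p = ≤-trans (n≤1+n j) (1≤valFrom⇒≤kFrom (suc j) ε p)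

zerosThenOne : ℕ → List Bool → List Bool
zerosThenOne i rest = zeros i ++ true ∷ rest

zerosThenOne-view : ∀ j ε → 1 ≤ valFrom j ε → ∃₂ λ i rest → ε ≡ zerosThenOne i rest
zerosThenOne-view j (true ∷ rest) _ = 0 , rest , refl
zerosThenOne-view j (false ∷ ε)   p with zerosThenOne-view (suc j) ε p
... | i , rest , refl = suc i , rest , refl

kFrom-zerosThenOne : ∀ j i rest → kFrom j (zerosThenOne i rest) ≡ j + i
kFrom-zerosThenOne j zero    rest = sym (+-identityʳ j)
kFrom-zerosThenOne j (suc i) rest = trans (kFrom-zerosThenOne (suc j) i rest) (sym (+-suc j i))

double : ℕ → ℕ
double zero    = 0
double (suc m) = suc (suc (double m))

dOfK-double : ∀ m → 1 ≤ double m → dOfK (double m) ≡ 2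
dOfK-double (suc zero)    _ = refl
dOfK-double (suc (suc m)) _ = dOfK-double (suc m) (s≤s z≤n)

dOfK≡2⇒double : ∀ k → dOfK k ≡ 2 → ∃ λ m → k ≡ double (suc m)
dOfK≡2⇒double (suc (suc zero))    _  = 0 , refl
dOfK≡2⇒double (suc (suc (suc k))) eq with dOfK≡2⇒double (suc k) eq
... | m , refl = suc m , refl

-- Carrying and borrowing

carry : ∀ j ε → NoAdj ε → ∃₂ λ m rest → NoAdj (zerosThenOne (double m) rest) ×
        βsumFrom j (zerosThenOne (double m) rest) ≡ βsumFrom j (true ∷ ε)
carry j []                 _  = 0 , [] , tt , refl
carry j (false ∷ ε)        na = 0 , false ∷ ε , na , refl
carry j (true ∷ true ∷ ε)  ()
-- Here βsumFrom j (true ∷ true ∷ []) and βsumFrom j (true ∷ true ∷ false ∷ []) agree by computation.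
carry j (true ∷ [])        _  with carry (2 + j) [] tt
... | m , rest , na′ , eq = suc m , rest , na′ , sym (βsumFrom-carry j [] (zerosThenOne (double m) rest) (sym eq))
carry j (true ∷ false ∷ ε) na with carry (2 + j) ε na
... | m , rest , na′ , eq = suc m , rest , na′ , sym (βsumFrom-carry j ε (zerosThenOne (double m) rest) (sym eq))

borrow : ∀ j m rest → NoAdj (zerosThenOne (double (suc m)) rest) → ∃ λ ξ → NoAdj (true ∷ ξ) ×
         βsumFrom j (true ∷ true ∷ ξ) ≡ βsumFrom j (zerosThenOne (double (suc m)) rest)
borrow j zero    rest na = false ∷ rest , NoAdj-∷⁻ true rest na , βsumFrom-carry j rest (true ∷ rest) refl
borrow j (suc m) rest na with borrow (2 + j) m rest na
... | ξ , naξ , eq = false ∷ true ∷ ξ , naξ , βsumFrom-carry j (true ∷ ξ) (zerosThenOne (double (suc m)) rest) eq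

δ∈Delta : ∀ {m} ε → NoAdj ε → m ≤ valFrom 0 ε → InDelta m (δ ε)
δ∈Delta ε na p = valFrom 0 ε , p , ε , (na , refl) , refl

δ-false∷∈A : ∀ ε → NoAdj ε → 1 ≤ valFrom 0 ε → InA (δ (false ∷ ε))
δ-false∷∈A ε na p = valFrom 0 ε , p , ε , (na , refl) , δ-false∷ ε

δ-true∷∈B : ∀ ε → NoAdj ε → 1 ≤ valFrom 0 ε → InB (δ (true ∷ ε))
δ-true∷∈B ε na p = valFrom 0 ε , p , ε , (na , refl) , δ-true∷ ε

InA⊎InB⇒InDelta2 : ∀ {y} → InA y ⊎ InB y → InDelta 2 y
InA⊎InB⇒InDelta2 (inj₁ (_ , p , ε , (na , refl) , refl)) =
  subst (InDelta 2) (δ-false∷ ε) (δ∈Delta (false ∷ ε) na (1≤valFrom⇒2≤valFrom-suc 0 ε p))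
InA⊎InB⇒InDelta2 (inj₂ (_ , p , ε , (na , refl) , refl)) with carry 0 ε na
... | m , rest , na′ , eq = subst (InDelta 2) δζ≡ (δ∈Delta ζ na′ 2≤valζ)
  where
  ζ : List Bool
  ζ = zerosThenOne (double m) rest
  δζ≡ : δ ζ ≡ β ⊗ δ ε ⊕ inv√5 ⊗ β ^ 2
  δζ≡ = trans (cong (inv√5 ⊗_) eq) (δ-true∷ ε)
  2≤valζ : 2 ≤ valFrom 0 ζ
  2≤valζ = subst (2 ≤_) (sym (βsumFrom≡⇒valFrom≡ 0 ζ (true ∷ ε) eq))
                 (s≤s (≤-trans (n≤1+n 1) (1≤valFrom⇒2≤valFrom-suc 0 ε p)))

InDelta2⇒InA⊎InB : ∀ {y} → InDelta 2 y → InA y ⊎ InB y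
InDelta2⇒InA⊎InB (_ , p , []               , (_  , refl) , refl) with () ← p
InDelta2⇒InA⊎InB (_ , p , true ∷ []        , (_  , refl) , refl) with s≤s () ← p
InDelta2⇒InA⊎InB (_ , _ , true ∷ true ∷ _  , (() , refl) , refl)
InDelta2⇒InA⊎InB (_ , p , false ∷ ε        , (na , refl) , refl) =
  inj₁ (δ-false∷∈A ε na (1≤valFrom-suc⇒1≤valFrom 0 ε (≤-trans (n≤1+n 1) p)))
InDelta2⇒InA⊎InB (_ , p , true ∷ false ∷ ε , (na , refl) , refl) =
  inj₂ (δ-true∷∈B (false ∷ ε) na (1≤valFrom-suc⇒1≤valFrom 1 ε (s≤s⁻¹ p)))

InA×InB⇒InD : ∀ {y} → InA y × InB y → InD y
InA×InB⇒InD ((_ , p , ε₁ , (na₁ , refl) , refl) , (_ , _ , ε₂ , (na₂ , refl) , y≡)) with carry 0 ε₂ na₂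
... | m , rest , na′ , eq = valFrom 1 ε₁ , pos , false ∷ ε₁ , (na₁ , refl) , d≡2 , sym (δ-false∷ ε₁)
  where
  open ≡-Reasoning
  pos : 1 ≤ valFrom 1 ε₁
  pos = ≤-trans (n≤1+n 1) (1≤valFrom⇒2≤valFrom-suc 0 ε₁ p)
  ζ : List Bool
  ζ = zerosThenOne (double m) rest
  same-δ : δ (false ∷ ε₁) ≡ δ ζ
  same-δ = begin
    δ (false ∷ ε₁)                 ≡⟨ δ-false∷ ε₁ ⟩
    β ⊗ δ ε₁                       ≡⟨ y≡ ⟩
    β ⊗ δ ε₂ ⊕ inv√5 ⊗ β ^ 2       ≡⟨ sym (δ-true∷ ε₂) ⟩
    δ (true ∷ ε₂)                  ≡⟨ cong (inv√5 ⊗_) (sym eq) ⟩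
    δ ζ                            ∎
  k≡ : kFrom 1 ε₁ ≡ double m
  k≡ = trans (kFrom-unique 0 (false ∷ ε₁) ζ na₁ na′ (δ≡⇒valFrom≡ (false ∷ ε₁) ζ same-δ))
             (kFrom-zerosThenOne 0 (double m) rest)
  d≡2 : dOfK (kFrom 1 ε₁) ≡ 2
  d≡2 = subst (λ k → dOfK k ≡ 2) (sym k≡)
              (dOfK-double m (subst (1 ≤_) k≡ (1≤valFrom⇒≤kFrom 1 ε₁ pos)))

InD⇒InA×InB : ∀ {y} → InD y → InA y × InB y
InD⇒InA×InB (_ , p , ε , (na , refl) , d≡2 , refl) with zerosThenOne-view 0 ε p
... | i , rest , refl with dOfK≡2⇒double i (trans (cong dOfK (sym (kFrom-zerosThenOne 0 i rest))) d≡2)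
... | m , refl with borrow 0 m rest na
... | ξ , naξ , eq =
  δ-false∷∈A tail na (1≤valFrom-suc⇒1≤valFrom 0 tail p) ,
  subst InB (cong (inv√5 ⊗_) eq) (δ-true∷∈B (true ∷ ξ) naξ (s≤s z≤n))
  where
  tail : List Bool
  tail = false ∷ zerosThenOne (double m) rest

corollary1 : (y : Q5) → ((InA y ⊎ InB y) ⇔ InDelta 2 y) × ((InA y × InB y) ⇔ InD y)
corollary1 y = mk⇔ InA⊎InB⇒InDelta2 InDelta2⇒InA⊎InB , mk⇔ InA×InB⇒InD InD⇒InA×InB
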